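{- Let $\mathsf V$ be a variety and $\theta\in\mathrm{Con}(\mathbf F_{\mathsf V}(z))$. Then $\theta$ is an E-congruence if and only if there are $m\ge1$ and exact congruences $\theta_1,\ldots,\theta_m\in\mathrm{Con}(\mathbf F_{\mathsf V}(z))$ such that $\theta=\bigcap_{k=1}^m\theta_k$.
   Context: $\mathbf F_{\mathsf V}(z)$ is the free algebra of $\mathsf V$ on one generator $z$. An algebra is exact in $\mathsf V$ if it is isomorphic to a finitely generated subalgebra of a finitely generated free algebra of $\mathsf V$; a congruence $\theta$ of $\mathbf F_{\mathsf V}(z)$ is exact if $\mathbf F_{\mathsf V}(z)/\theta$ is exact. An algebraic e-generalization problem is a homomorphism $h:\mathbf F_{\mathsf V}(z)\to\prod_{k=1}^m\mathbf E_k$ ($m\ge1$) with each $\mathbf E_k$ a 1-generated exact algebra in $\mathsf V$ and each $p_k\circ h$ surjective ($p_k$ the $k$-th projection). A congruence $\theta$ of $\mathbf F_{\mathsf V}(z)$ is an E-congruence if $\theta=\ker(h)$ for some algebraic e-generalization problem $h$. -}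

module Defs where

open import Data.Nat using (ℕ; _≤_)
open import Data.Fin using (Fin)
open import Data.Unit using (⊤)
open import Data.Product using (Σ; ∃; ∃-syntax; _×_; _,_; proj₁; proj₂)
open import Relation.Binary.Core using (Rel)
open import Relation.Binary.Structures using (IsEquivalence)
open import Function.Bundles using (_⇔_)

record Signature : Set₁ where
  field
    Op : Set
    ar : Op → ℕ
open Signature public

data Term (S : Signature) (X : Set) : Set where
  var  : X → Term S X
  node : (o : Op S) → (Fin (ar S o) → Term S X) → Term S X

sub : {S : Signature} {X Y : Set} → (Y → Term S X) → Term S Y → Term S X
sub σ (var y)     = σ y
sub σ (node o ts) = node o (λ i → sub σ (ts i))

-- A variety is the class of models of a set of identities (in countably
-- many variables) over a signature.
record Variety : Set₁ where
  field
    sig : Signature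
    Ax  : Set
    lhs : Ax → Term sig ℕ
    rhs : Ax → Term sig ℕ
open Variety public

-- Equational consequence: the fully invariant congruence of Term X
-- generated by the identities of V.  Term X modulo this is F_V(X).
data _⊢_≋_ (V : Variety) {X : Set} : Term (sig V) X → Term (sig V) X → Set where
  ax    : (a : Ax V) (σ : ℕ → Term (sig V) X) → V ⊢ sub σ (lhs V a) ≋ sub σ (rhs V a)
  refl  : ∀ {s} → V ⊢ s ≋ s
  sym   : ∀ {s t} → V ⊢ s ≋ t → V ⊢ t ≋ s
  trans : ∀ {s t u} → V ⊢ s ≋ t → V ⊢ t ≋ u → V ⊢ s ≋ u
  cong  : ∀ o {ss ts} → (∀ i → V ⊢ ss i ≋ ts i) → V ⊢ node o ss ≋ node o ts

record Algebra (S : Signature) : Set₁ where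
  field
    Carrier : Set
    _≈_     : Rel Carrier _
    isEquiv : IsEquivalence _≈_
    op      : (o : Op S) → (Fin (ar S o) → Carrier) → Carrier
    op-cong : ∀ o {as bs} → (∀ i → as i ≈ bs i) → op o as ≈ op o bs
open Algebra public

eval : {S : Signature} {X : Set} (A : Algebra S) → (X → Carrier A) → Term S X → Carrier A
eval A ρ (var x)     = ρ x
eval A ρ (node o ts) = op A o (λ i → eval A ρ (ts i))

record IsHom {S : Signature} (A B : Algebra S) (f : Carrier A → Carrier B) : Set where
  field
    f-cong : ∀ {a a'} → _≈_ A a a' → _≈_ B (f a) (f a')
    f-op   : ∀ o as → _≈_ B (f (op A o as)) (op B o (λ i → f (as i)))

_≅_ : {S : Signature} → Algebra S → Algebra S → Set
A ≅ B = Σ (Carrier A → Carrier B) λ f → Σ (Carrier B → Carrier A) λ g →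
          IsHom A B f
          × (∀ {b b'} → _≈_ B b b' → _≈_ A (g b) (g b'))
          × (∀ a → _≈_ A (g (f a)) a)
          × (∀ b → _≈_ B (f (g b)) b)

Surj : {S : Signature} (A B : Algebra S) → (Carrier A → Carrier B) → Set
Surj A B f = ∀ b → ∃[ a ] _≈_ B (f a) b

OneGenerated : {S : Signature} → Algebra S → Set
OneGenerated A = ∃[ a ] ∀ b → ∃[ t ] _≈_ A b (eval A (λ (_ : ⊤) → a) t)

Sg : {S : Signature} (B : Algebra S) {k : ℕ} → (Fin k → Carrier B) → Algebra S
Sg {S} B {k} g = record
  { Carrier = Σ (Carrier B) λ x → ∃[ t ] _≈_ B x (eval B g t)
  ; _≈_     = λ x y → _≈_ B (proj₁ x) (proj₁ y)
  ; isEquiv = record { refl = E.refl ; sym = E.sym ; trans = E.trans }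
  ; op      = λ o as → op B o (λ i → proj₁ (as i))
                     , node o (λ i → proj₁ (proj₂ (as i)))
                     , op-cong B o (λ i → proj₂ (proj₂ (as i)))
  ; op-cong = λ o eqs → op-cong B o eqs
  }
  where module E = IsEquivalence (isEquiv B)

Prod : {S : Signature} {m : ℕ} → (Fin m → Algebra S) → Algebra S
Prod {S} E = record
  { Carrier = (k : Fin _) → Carrier (E k)
  ; _≈_     = λ x y → ∀ k → _≈_ (E k) (x k) (y k)
  ; isEquiv = record { refl = λ k → IsEquivalence.refl (isEquiv (E k))
                     ; sym = λ p k → IsEquivalence.sym (isEquiv (E k)) (p k)
                     ; trans = λ p q k → IsEquivalence.trans (isEquiv (E k)) (p k) (q k) }
  ; op      = λ o as k → op (E k) o (λ i → as i k)
  ; op-cong = λ o eqs k → op-cong (E k) o (λ i → eqs i k)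
  }

F : (V : Variety) (X : Set) → Algebra (sig V)
F V X = record
  { Carrier = Term (sig V) X
  ; _≈_     = λ s t → V ⊢ s ≋ t
  ; isEquiv = record { refl = refl ; sym = sym ; trans = trans }
  ; op      = node
  ; op-cong = cong
  }

Fz : (V : Variety) → Algebra (sig V)
Fz V = F V ⊤

RelFz : Variety → Set₁
RelFz V = Term (sig V) ⊤ → Term (sig V) ⊤ → Set

-- congruences of F_V(z): equivalences on terms that contain V-equality
-- and are compatible with the operations
record IsCongruence (V : Variety) (θ : RelFz V) : Set where
  field
    equiv  : IsEquivalence θ
    ⊇free  : ∀ {s t} → V ⊢ s ≋ t → θ s t
    compat : ∀ o {ss ts} → (∀ i → θ (ss i) (ts i)) → θ (node o ss) (node o ts)

Quot : (V : Variety) (θ : RelFz V) → IsCongruence V θ → Algebra (sig V)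
Quot V θ c = record
  { Carrier = Term (sig V) ⊤
  ; _≈_     = θ
  ; isEquiv = IsCongruence.equiv c
  ; op      = node
  ; op-cong = IsCongruence.compat c
  }

IsExact : (V : Variety) → Algebra (sig V) → Set
IsExact V A = ∃[ n ] ∃[ k ] Σ (Fin k → Term (sig V) (Fin n)) λ g → A ≅ Sg (F V (Fin n)) g

ExactCong : (V : Variety) → RelFz V → Set
ExactCong V θ = Σ (IsCongruence V θ) λ c → IsExact V (Quot V θ c)

ker : (V : Variety) {B : Algebra (sig V)} → (Term (sig V) ⊤ → Carrier B) → RelFz V
ker V {B} h s t = _≈_ B (h s) (h t)

-- E-congruence: kernel of an algebraic e-generalization problem
-- h : F_V(z) → ∏_{k=1}^m E_k
ECong : (V : Variety) → RelFz V → Set₁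
ECong V θ =
  ∃[ m ] (1 ≤ m) ×
  Σ (Fin m → Algebra (sig V)) λ E →
    (∀ k → OneGenerated (E k) × IsExact V (E k)) ×
    Σ (Term (sig V) ⊤ → Carrier (Prod E)) λ h →
      IsHom (Fz V) (Prod E) h ×
      (∀ k → Surj (Fz V) (E k) (λ x → h x k)) ×
      (∀ s t → θ s t ⇔ ker V {Prod E} h s t)

-- An algebraic e-generalization problem h : F_V(z) → ∏ E_k has kernel ⋂ ker (p_k ∘ h),
-- and since p_k ∘ h is onto, F_V(z)/ker (p_k ∘ h) ≅ E_k is exact: so an E-congruence is
-- an intersection of exact congruences.  Conversely, for exact θ_1, …, θ_m the natural map
-- F_V(z) → ∏ F_V(z)/θ_k is an e-generalization problem (each factor is generated by the
-- class of z) whose kernel is ⋂ θ_k.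
module Submission where

open import Defs
open import Data.Nat using (_≤_)
open import Data.Fin using (Fin)
open import Data.Product using (Σ; ∃-syntax; _×_; _,_; proj₁; proj₂)
open import Data.Unit using (⊤; tt)
open import Function.Bundles using (_⇔_; mk⇔)
open import Relation.Binary.Structures using (IsEquivalence)

module _ {S : Signature} where

  ≅-trans : {A B C : Algebra S} → A ≅ B → B ≅ C → A ≅ C
  ≅-trans {A} {C = C} (f , g , f-hom , g-cong , gf , fg) (f′ , g′ , f′-hom , g′-cong , g′f′ , f′g′) =
    (λ a → f′ (f a)) , (λ c → g (g′ c)) , comp-hom ,
    (λ c≈c′ → g-cong (g′-cong c≈c′)) ,
    (λ a → A.trans (g-cong (g′f′ (f a))) (gf a)) ,
    (λ c → C.trans (IsHom.f-cong f′-hom (fg (g′ c))) (f′g′ c))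
    where
    module A = IsEquivalence (isEquiv A)
    module C = IsEquivalence (isEquiv C)
    comp-hom : IsHom A C (λ a → f′ (f a))
    comp-hom = record
      { f-cong = λ a≈a′ → IsHom.f-cong f′-hom (IsHom.f-cong f-hom a≈a′)
      ; f-op   = λ o as → C.trans (IsHom.f-cong f′-hom (IsHom.f-op f-hom o as))
                                  (IsHom.f-op f′-hom o (λ i → f (as i)))
      }

module _ {V : Variety} where

  IsExact-resp-≅ : {A B : Algebra (sig V)} → A ≅ B → IsExact V B → IsExact V A
  IsExact-resp-≅ A≅B (n , k , g , B≅Sg) = n , k , g , ≅-trans A≅B B≅Sg

  module _ {B : Algebra (sig V)} {h : Term (sig V) ⊤ → Carrier B} (h-hom : IsHom (Fz V) B h) where

    private module B = IsEquivalence (isEquiv B)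

    ker-isCongruence : IsCongruence V (ker V {B} h)
    ker-isCongruence = record
      { equiv  = record { refl = B.refl ; sym = B.sym ; trans = B.trans }
      ; ⊇free  = IsHom.f-cong h-hom
      ; compat = λ o {ss} {ts} ss≈ts →
          B.trans (IsHom.f-op h-hom o ss) (B.trans (op-cong B o ss≈ts) (B.sym (IsHom.f-op h-hom o ts)))
      }

    Quot-ker≅ : Surj (Fz V) B h → Quot V (ker V {B} h) ker-isCongruence ≅ B
    Quot-ker≅ h-surj =
      h , preimage , record { f-cong = λ e → e ; f-op = IsHom.f-op h-hom } ,
      (λ {b} {b′} b≈b′ → B.trans (h-surj b .proj₂) (B.trans b≈b′ (B.sym (h-surj b′ .proj₂)))) ,
      (λ s → h-surj (h s) .proj₂) ,
      (λ b → h-surj b .proj₂)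
      where
      preimage : Carrier B → Term (sig V) ⊤
      preimage b = h-surj b .proj₁

  module _ {θ : RelFz V} (c : IsCongruence V θ) where

    private module Θ = IsEquivalence (IsCongruence.equiv c)

    Quot-oneGenerated : OneGenerated (Quot V θ c)
    Quot-oneGenerated = var tt , λ t → t , eval-z t
      where
      eval-z : ∀ t → θ t (eval (Quot V θ c) (λ _ → var tt) t)
      eval-z (var _)     = Θ.refl
      eval-z (node o ts) = IsCongruence.compat c o (λ i → eval-z (ts i))

    quotient-isHom : IsHom (Fz V) (Quot V θ c) (λ s → s)
    quotient-isHom = record { f-cong = IsCongruence.⊇free c ; f-op = λ _ _ → Θ.refl }

    quotient-surj : Surj (Fz V) (Quot V θ c) (λ s → s)
    quotient-surj t = t , Θ.refl

ECong⇒⋂ExactCong : (V : Variety) (θ : RelFz V) → ECong V θ →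
  ∃[ m ] (1 ≤ m) × Σ (Fin m → RelFz V) λ θs →
    (∀ k → ExactCong V (θs k)) × (∀ s t → θ s t ⇔ (∀ k → θs k s t))
ECong⇒⋂ExactCong V θ (m , 1≤m , E , E-gen-exact , h , h-hom , h-surj , θ⇔ker) =
  m , 1≤m , (λ k → ker V {E k} (hₖ k)) , exact , θ⇔ker
  where
  hₖ : ∀ k → Term (sig V) ⊤ → Carrier (E k)
  hₖ k s = h s k
  hₖ-hom : ∀ k → IsHom (Fz V) (E k) (hₖ k)
  hₖ-hom k = record { f-cong = λ e → IsHom.f-cong h-hom e k ; f-op = λ o as → IsHom.f-op h-hom o as k }
  exact : ∀ k → ExactCong V (ker V {E k} (hₖ k))
  exact k = ker-isCongruence (hₖ-hom k) ,
            IsExact-resp-≅ (Quot-ker≅ (hₖ-hom k) (h-surj k)) (E-gen-exact k .proj₂)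

⋂ExactCong⇒ECong : (V : Variety) (θ : RelFz V) →
  (∃[ m ] (1 ≤ m) × Σ (Fin m → RelFz V) λ θs →
    (∀ k → ExactCong V (θs k)) × (∀ s t → θ s t ⇔ (∀ k → θs k s t))) →
  ECong V θ
⋂ExactCong⇒ECong V θ (m , 1≤m , θs , θs-exact , θ⇔⋂) =
  m , 1≤m , E , (λ k → Quot-oneGenerated (c k) , θs-exact k .proj₂) ,
  (λ s k → s) ,
  record { f-cong = λ e k → IsHom.f-cong (quotient-isHom (c k)) e
         ; f-op   = λ o as k → IsHom.f-op (quotient-isHom (c k)) o as } ,
  (λ k → quotient-surj (c k)) ,
  θ⇔⋂
  where
  c : ∀ k → IsCongruence V (θs k)
  c k = θs-exact k .proj₁
  E : Fin m → Algebra (sig V)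
  E k = Quot V (θs k) (c k)

theorem4p4 : (V : Variety) (θ : RelFz V) → IsCongruence V θ →
    ECong V θ ⇔
      (∃[ m ] (1 ≤ m) × Σ (Fin m → RelFz V) λ θs →
        (∀ k → ExactCong V (θs k)) × (∀ s t → θ s t ⇔ (∀ k → θs k s t)))
theorem4p4 V θ _ = mk⇔ (ECong⇒⋂ExactCong V θ) (⋂ExactCong⇒ECong V θ)
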